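{- For every $q=2^n$ ($n\ge 1$) there exist quadratic forms $\phi,\chi$ in $x,y,z$ over $\mathbb{F}_q$ such that for every $(\alpha:\beta)\in\mathrm{PG}(1,q)$ the conic $\alpha\phi+\beta\chi=0$ in $\mathrm{PG}(2,q)$ is non-singular and is a translation oval, and any two distinct members of the pencil $\{\alpha\phi+\beta\chi:(\alpha:\beta)\in\mathrm{PG}(1,q)\}$ intersect in $\mathrm{PG}(2,q)$ only in the point $(0:0:1)$.
   Context: An oval in $\mathrm{PG}(2,q)$ is a set of $q+1$ points, no three collinear. For $q=2^n$, an oval $\mathcal{O}$ is a translation oval if $(x_0+x_1:y_0+y_1:1)\in\mathcal{O}$ for all $(x_0:y_0:1),(x_1:y_1:1)\in\mathcal{O}$. Two translation ovals meeting only in $(0:0:1)$ are called trivially intersecting; the statement asserts the existence of a trivially intersecting pencil of non-singular conic translation ovals. -}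

module Defs where

open import Data.Nat using (ℕ; suc) renaming (_^_ to _^ℕ_)
open import Data.Fin using (Fin)
open import Data.Product using (Σ; _×_; _,_)
open import Relation.Nullary using (¬_)
open import Relation.Binary.PropositionalEquality using (_≡_)
open import Algebra.Structures using (IsCommutativeRing)
open import Function.Bundles using (_↔_)

record GF2^ (n : ℕ) : Set₁ where
  infixl 6 _+_
  infixl 7 _*_
  field
    F    : Set
    _+_  : F → F → F
    _*_  : F → F → F
    -_   : F → F
    0#   : F
    1#   : F
    isCommutativeRing : IsCommutativeRing _≡_ _+_ _*_ -_ 0# 1#
    0≢1  : ¬ (0# ≡ 1#)
    inv  : (x : F) → ¬ (x ≡ 0#) → F
    inv-l : (x : F) (p : ¬ (x ≡ 0#)) → inv x p * x ≡ 1#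
    size : F ↔ Fin (2 ^ℕ n)

module _ {n : ℕ} (K : GF2^ n) where
  open GF2^ K

  q : ℕ
  q = 2 ^ℕ n

  record QForm : Set where
    constructor qform
    field a b c f g h : F

  eval : QForm → F → F → F → F
  eval (qform a b c f g h) x y z =
    a * x * x + b * y * y + c * z * z + f * y * z + g * z * x + h * x * y

  lin : F → QForm → F → QForm → QForm
  lin α (qform a b c f g h) β (qform a' b' c' f' g' h') =
    qform (α * a + β * a') (α * b + β * b') (α * c + β * c')
          (α * f + β * f') (α * g + β * g') (α * h + β * h')

  Δ : QForm → F
  Δ (qform a b c f g h) =
    (1# + 1# + 1# + 1#) * a * b * c + - (a * f * f) + - (b * g * g) + - (c * h * h) + f * g * h

  NonSingular : QForm → Set
  NonSingular Q = ¬ (Δ Q ≡ 0#)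

  data PG2 : Set where
    aff : F → F → PG2
    atInf : F → PG2
    ideal : PG2

  coords : PG2 → F × F × F
  coords (aff x y) = x , y , 1#
  coords (atInf x) = x , 1# , 0#
  coords ideal = 1# , 0# , 0#

  data PG1 : Set where
    fin : F → PG1
    infty : PG1

  coords1 : PG1 → F × F
  coords1 (fin α) = α , 1#
  coords1 infty = 1# , 0#

  OnConic : QForm → PG2 → Set
  OnConic Q P with coords P
  ... | x , y , z = eval Q x y z ≡ 0#

  det3 : F × F × F → F × F × F → F × F × F → F
  det3 (a1 , a2 , a3) (b1 , b2 , b3) (c1 , c2 , c3) =
    a1 * (b2 * c3 + - (b3 * c2)) + - (a2 * (b1 * c3 + - (b3 * c1))) + a3 * (b1 * c2 + - (b2 * c1))

  Collinear : PG2 → PG2 → PG2 → Set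
  Collinear P Q R = det3 (coords P) (coords Q) (coords R) ≡ 0#

  IsOval : (PG2 → Set) → Set
  IsOval O =
    (Fin (suc q) ↔ Σ PG2 O) ×
    ((P Q R : PG2) → O P → O Q → O R →
       ¬ (P ≡ Q) → ¬ (Q ≡ R) → ¬ (P ≡ R) → ¬ Collinear P Q R)

  IsTranslationOval : (PG2 → Set) → Set
  IsTranslationOval O =
    IsOval O ×
    ((x₀ y₀ x₁ y₁ : F) → O (aff x₀ y₀) → O (aff x₁ y₁) → O (aff (x₀ + x₁) (y₀ + y₁)))

  Member : QForm → QForm → PG1 → QForm
  Member φ χ t with coords1 t
  ... | α , β = lin α φ β χ

  TIPencil : Set
  TIPencil =
    Σ QForm λ φ → Σ QForm λ χ →
      ((t : PG1) → NonSingular (Member φ χ t) × IsTranslationOval (OnConic (Member φ χ t))) ×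
      ((s t : PG1) → ¬ (s ≡ t) → (P : PG2) →
         (OnConic (Member φ χ s) P × OnConic (Member φ χ t) P) → P ≡ aff 0# 0#)

module Submission where

-- In characteristic 2 the conic a x² + b y² + f yz + g zx is non-singular iff
-- a f² + b g² ≠ 0.  It then passes through (0:0:1), and the lines through that
-- point parametrise it by (u:v) ↦ (u L : v L : M) with L = g u + f v and
-- M = a u² + b v²; any three of these points have determinant
-- (a f² + b g²) times the three 2×2 minors of the parameters, so no three are
-- collinear, and its affine equation a x² + b y² + f y + g x is additive, so it
-- is a translation oval.
--
-- Let X³ + c₂ X² + c₁ X + c₀ have no root; one exists because
-- (r, s, t) ↦ coefficients of (X + r)(X² + s X + t) is a non-injective map of
-- the finite set F³ to itself.  For φ = x² + c₁ y² + yz and χ = c₂ x² + c₀ y² + zx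
-- the member α φ + β χ has a f² + b g² = N(α, β), where
-- N(x, y) = x³ + c₂ x² y + c₁ x y² + c₀ y³ vanishes only at 0, and a common point
-- of two members satisfies φ = χ = 0, hence N(x, y) = x φ + y χ = 0, so x = y = 0.
--
-- Characteristic 2 holds because negation is an involution of a set of even
-- size 2ⁿ, so it must have a fixed point besides 0.

open import Defs
open import Data.Nat using (ℕ; zero; suc; _≥_; _^_; parity) renaming (_*_ to _*ℕ_)
import Data.Nat.Properties as ℕ
open import Data.Parity using (0ℙ; 1ℙ; _⁻¹)
open import Data.Parity.Properties using (suc-homo-⁻¹; *-homo-*)
open import Data.Fin using (Fin; zero; suc; punchIn; punchOut)
open import Data.Fin.Properties
  using (any?; all?; ¬∀⟶∃¬; injective⇒≤; punchOut-injective; punchIn-punchOut; punchInᵢ≢i;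
         punchIn-injective; suc-injective; inj⇒≟; *↔×)
  renaming (_≟_ to _≟ᶠ_)
open import Data.Bool using (Bool; true; false)
import Data.Bool.Properties as Bool
open import Data.Maybe using (Maybe; just; nothing)
open import Data.Product using (Σ; ∃; _×_; _,_; proj₁; proj₂; uncurry)
open import Data.Product.Properties using (Σ-≡,≡→≡)
open import Data.Product.Function.NonDependent.Propositional using (_×-↔_)
open import Data.Empty using (⊥-elim)
open import Function using (_∘_)
open import Function.Bundles using (Inverse; _↔_; mk↔ₛ′)
open import Function.Definitions using (Injective)
open import Function.Properties.Inverse using (↔⇒↣; ↔-sym; ↔-trans)
open import Algebra.Bundles using (CommutativeRing; AbelianGroup)
open import Algebra.Definitions using (Involutive)
open import Algebra.Structures using (IsCommutativeRing)
import Algebra.Properties.Group as GroupProperties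
open import Algebra.Solver.Ring.AlmostCommutativeRing using (_-Raw-AlmostCommutative⟶_; fromCommutativeRing)
import Algebra.Solver.Ring as RingSolver
open import Axiom.UniquenessOfIdentityProofs using (module Decidable⇒UIP)
open import Relation.Nullary using (¬_; Dec; yes; no; contradiction; _×-dec_)
open import Relation.Binary.Definitions using (DecidableEquality)
open import Relation.Binary.PropositionalEquality

-- Involutions of finite sets

record Restriction {M N : ℕ} (τ : Fin M → Fin M) (σ : Fin N → Fin N) : Set where
  field
    embed           : Fin N → Fin M
    embed-injective : Injective _≡_ _≡_ embed
    embed-commutes  : ∀ k → embed (σ k) ≡ τ (embed k)

  involutive : Involutive _≡_ τ → Involutive _≡_ σ
  involutive τ-inv k = embed-injective (begin
    embed (σ (σ k))  ≡⟨ embed-commutes (σ k) ⟩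
    τ (embed (σ k))  ≡⟨ cong τ (embed-commutes k) ⟩
    τ (τ (embed k))  ≡⟨ τ-inv (embed k) ⟩
    embed k          ∎)
    where open ≡-Reasoning

  σ-fixed⇒τ-fixed : ∀ {k} → σ k ≡ k → τ (embed k) ≡ embed k
  σ-fixed⇒τ-fixed {k} σk≡k = trans (sym (embed-commutes k)) (cong embed σk≡k)

  τ-fixed⇒σ-fixed : ∀ {k} → τ (embed k) ≡ embed k → σ k ≡ k
  τ-fixed⇒σ-fixed {k} fixed = embed-injective (trans (embed-commutes k) fixed)

module DropFixedZero {M : ℕ} (τ : Fin (suc M) → Fin (suc M))
                     (τ-inv : Involutive _≡_ τ) (τ0≡0 : τ zero ≡ zero) where

  0≢τ1+k : ∀ k → zero ≢ τ (suc k)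
  0≢τ1+k k 0≡τ1+k with trans (sym (τ-inv (suc k))) (trans (cong τ (sym 0≡τ1+k)) τ0≡0)
  ... | ()

  σ : Fin M → Fin M
  σ k = punchOut (0≢τ1+k k)

  restriction : Restriction τ σ
  restriction = record
    { embed           = suc
    ; embed-injective = suc-injective
    ; embed-commutes  = λ k → punchIn-punchOut (0≢τ1+k k)
    }

module DropTwoCycle {M : ℕ} (τ : Fin (suc (suc M)) → Fin (suc (suc M)))
                    (τ-inv : Involutive _≡_ τ) {j : Fin (suc M)} (τ0≡1+j : τ zero ≡ suc j) where

  embed : Fin M → Fin (suc (suc M))
  embed k = suc (punchIn j k)

  complement⊆image : ∀ {x} → x ≢ zero → x ≢ suc j → ∃ λ k → embed k ≡ x
  complement⊆image {zero}  x≢0 _    = ⊥-elim (x≢0 refl)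
  complement⊆image {suc m} _   x≢1+j = punchOut j≢m , cong suc (punchIn-punchOut j≢m)
    where j≢m = λ j≡m → x≢1+j (cong suc (sym j≡m))

  τ1+j≡0 : τ (suc j) ≡ zero
  τ1+j≡0 = trans (cong τ (sym τ0≡1+j)) (τ-inv zero)

  τ-embed≢0 : ∀ k → τ (embed k) ≢ zero
  τ-embed≢0 k τe≡0 = punchInᵢ≢i j k (suc-injective (begin
    embed k          ≡⟨ sym (τ-inv (embed k)) ⟩
    τ (τ (embed k))  ≡⟨ cong τ τe≡0 ⟩
    τ zero           ≡⟨ τ0≡1+j ⟩
    suc j            ∎))
    where open ≡-Reasoning

  τ-embed≢1+j : ∀ k → τ (embed k) ≢ suc j
  τ-embed≢1+j k τe≡1+j with trans (sym (τ-inv (embed k))) (trans (cong τ τe≡1+j) τ1+j≡0)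
  ... | ()

  σ : Fin M → Fin M
  σ k = proj₁ (complement⊆image (τ-embed≢0 k) (τ-embed≢1+j k))

  restriction : Restriction τ σ
  restriction = record
    { embed           = embed
    ; embed-injective = punchIn-injective j _ _ ∘ suc-injective
    ; embed-commutes  = λ k → proj₂ (complement⊆image (τ-embed≢0 k) (τ-embed≢1+j k))
    }

  fixed⊆image : ∀ {y} → τ y ≡ y → ∃ λ k → embed k ≡ y
  fixed⊆image {y} τy≡y = complement⊆image y≢0 y≢1+j
    where
    y≢0 : y ≢ zero
    y≢0 refl with trans (sym τ0≡1+j) τy≡y
    ... | ()
    y≢1+j : y ≢ suc j
    y≢1+j refl with trans (sym τ1+j≡0) τy≡y
    ... | ()

fixedPointFree⇒even : ∀ {M} (τ : Fin M → Fin M) → Involutive _≡_ τ →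
                      (∀ i → τ i ≢ i) → parity M ≡ 0ℙ
fixedPointFree⇒even {zero}        _ _     _    = refl
fixedPointFree⇒even {suc zero}    τ _     free with τ zero in eq
... | zero = ⊥-elim (free zero eq)
fixedPointFree⇒even {suc (suc M)} τ τ-inv free with τ zero in eq
... | zero  = ⊥-elim (free zero eq)
... | suc j = fixedPointFree⇒even σ (involutive τ-inv) (λ k → free (embed k) ∘ σ-fixed⇒τ-fixed)
  where open DropTwoCycle τ τ-inv eq using (σ; restriction)
        open Restriction restriction

uniqueFixedPoint⇒odd : ∀ {M} (τ : Fin M → Fin M) → Involutive _≡_ τ →
                       ∀ {p} → τ p ≡ p → (∀ i → τ i ≡ i → i ≡ p) → parity M ≡ 1ℙ
uniqueFixedPoint⇒odd {suc zero}    _ _     _    _      = refl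
uniqueFixedPoint⇒odd {suc (suc M)} τ τ-inv τp≡p unique with τ zero in eq
... | zero  = trans (sym (suc-homo-⁻¹ M)) (cong _⁻¹ (fixedPointFree⇒even σ (involutive τ-inv) free))
  where
  open DropFixedZero τ τ-inv eq using (σ; restriction)
  open Restriction restriction
  free : ∀ k → σ k ≢ k
  free k σk≡k with trans (unique (suc k) (σ-fixed⇒τ-fixed σk≡k)) (sym (unique zero eq))
  ... | ()
... | suc j = uniqueFixedPoint⇒odd σ (involutive τ-inv) (τ-fixed⇒σ-fixed τe₀≡e₀) unique′
  where
  open DropTwoCycle τ τ-inv eq using (σ; restriction; fixed⊆image)
  open Restriction restriction
  k₀ = proj₁ (fixed⊆image τp≡p)
  e₀≡p = proj₂ (fixed⊆image τp≡p)
  τe₀≡e₀ : τ (embed k₀) ≡ embed k₀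
  τe₀≡e₀ = trans (cong τ e₀≡p) (trans τp≡p (sym e₀≡p))
  unique′ : ∀ k → σ k ≡ k → k ≡ k₀
  unique′ k σk≡k = embed-injective (trans (unique (embed k) (σ-fixed⇒τ-fixed σk≡k)) (sym e₀≡p))

involution-uniqueFixedPoint⇒odd : ∀ {A : Set} {N} → A ↔ Fin N → (τ : A → A) → Involutive _≡_ τ →
                                  ∀ {p} → τ p ≡ p → (∀ x → τ x ≡ x → x ≡ p) → parity N ≡ 1ℙ
involution-uniqueFixedPoint⇒odd A↔Fin τ τ-inv {p} τp≡p unique =
  uniqueFixedPoint⇒odd τ′ τ′-inv (cong to τ′p≡p) unique′
  where
  open Inverse A↔Fin
  τ′ : Fin _ → Fin _
  τ′ i = to (τ (from i))
  τ′p≡p : τ (from (to p)) ≡ p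
  τ′p≡p = trans (cong τ (strictlyInverseʳ p)) τp≡p
  τ′-inv : Involutive _≡_ τ′
  τ′-inv i = trans (cong (to ∘ τ) (strictlyInverseʳ _))
                   (trans (cong to (τ-inv (from i))) (strictlyInverseˡ i))
  unique′ : ∀ i → τ′ i ≡ i → i ≡ to p
  unique′ i τ′i≡i = trans (sym (strictlyInverseˡ i)) (cong to (unique (from i) fixed))
    where fixed = trans (sym (strictlyInverseʳ _)) (cong from τ′i≡i)

-- Maps of finite sets

injective⇒surjective : ∀ {N} {f : Fin N → Fin N} → Injective _≡_ _≡_ f → ∀ y → ∃ λ x → f x ≡ y
injective⇒surjective {suc N} {f} f-inj y with any? (λ x → f x ≟ᶠ y)
... | yes hit = hit
... | no miss = contradiction (injective⇒≤ (f-inj ∘ punchOut-injective y≢f y≢f)) ℕ.1+n≰n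
  where
  y≢f : ∀ {x} → y ≢ f x
  y≢f {x} y≡fx = miss (x , sym y≡fx)

nonInjective⇒nonSurjective : ∀ {N} (h : Fin N → Fin N) {a b} → a ≢ b → h a ≡ h b →
                             ∃ λ y → ∀ x → h x ≢ y
nonInjective⇒nonSurjective h {a} {b} a≢b ha≡hb with all? (λ y → any? (λ x → h x ≟ᶠ y))
... | no ¬surjective =
  let y , ¬hit = ¬∀⟶∃¬ _ _ (λ y → any? (λ x → h x ≟ᶠ y)) ¬surjective in y , λ x hx≡y → ¬hit (x , hx≡y)
... | yes surjective = contradiction (begin
    a     ≡⟨ sym (proj₂ (s-surjective a)) ⟩
    s ya  ≡⟨ cong s ya≡yb ⟩
    s yb  ≡⟨ proj₂ (s-surjective b) ⟩
    b     ∎) a≢b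
  where
  open ≡-Reasoning
  s : Fin _ → Fin _
  s y = proj₁ (surjective y)
  h∘s≡id : ∀ y → h (s y) ≡ y
  h∘s≡id y = proj₂ (surjective y)
  s-injective : Injective _≡_ _≡_ s
  s-injective {y} {y′} sy≡sy′ = trans (sym (h∘s≡id y)) (trans (cong h sy≡sy′) (h∘s≡id y′))
  s-surjective = injective⇒surjective s-injective
  ya = proj₁ (s-surjective a)
  yb = proj₁ (s-surjective b)
  ya≡yb : ya ≡ yb
  ya≡yb = begin
    ya          ≡⟨ sym (h∘s≡id ya) ⟩
    h (s ya)    ≡⟨ cong h (proj₂ (s-surjective a)) ⟩
    h a         ≡⟨ ha≡hb ⟩
    h b         ≡⟨ cong h (sym (proj₂ (s-surjective b))) ⟩
    h (s yb)    ≡⟨ h∘s≡id yb ⟩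
    yb          ∎

finite-nonInjective⇒nonSurjective : ∀ {A : Set} {N} → A ↔ Fin N → (h : A → A) {a b : A} →
                                    a ≢ b → h a ≡ h b → ∃ λ y → ∀ x → h x ≢ y
finite-nonInjective⇒nonSurjective A↔Fin h {a} {b} a≢b ha≡hb =
  let y , missed = nonInjective⇒nonSurjective h′ (a≢b ∘ to-injective) (cong to h′a≡h′b)
  in from y , λ x hx≡y → missed (to x)
       (trans (cong (to ∘ h) (strictlyInverseʳ x)) (trans (cong to hx≡y) (strictlyInverseˡ y)))
  where
  open Inverse A↔Fin
  h′ : Fin _ → Fin _
  h′ i = to (h (from i))
  to-injective : Injective _≡_ _≡_ to
  to-injective {x} {y} tx≡ty = trans (sym (strictlyInverseʳ x)) (trans (cong from tx≡ty) (strictlyInverseʳ y))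
  h′a≡h′b : h (from (to a)) ≡ h (from (to b))
  h′a≡h′b = trans (cong h (strictlyInverseʳ a)) (trans ha≡hb (sym (cong h (strictlyInverseʳ b))))

-- Finite fields of order 2ⁿ

parity-2^ : ∀ m → m ≥ 1 → parity (2 ^ m) ≡ 0ℙ
parity-2^ (suc m) _ = *-homo-* 2 (2 ^ m)

module Field {n : ℕ} (K : GF2^ n) where
  open GF2^ K
  open IsCommutativeRing isCommutativeRing
    using (+-identityˡ; +-identityʳ; -‿inverseˡ; zeroˡ; zeroʳ; *-assoc; *-comm; *-identityˡ; *-identityʳ; distribʳ)

  infix 4 _≟_
  _≟_ : DecidableEquality F
  _≟_ = inj⇒≟ (↔⇒↣ size)

  1≢0 : 1# ≢ 0#
  1≢0 = 0≢1 ∘ sym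

  inv-r : ∀ x (x≢0 : x ≢ 0#) → x * inv x x≢0 ≡ 1#
  inv-r x x≢0 = trans (*-comm x _) (inv-l x x≢0)

  inv≢0 : ∀ x (x≢0 : x ≢ 0#) → inv x x≢0 ≢ 0#
  inv≢0 x x≢0 x⁻¹≡0 = 0≢1 (trans (sym (zeroˡ x)) (trans (cong (_* x) (sym x⁻¹≡0)) (inv-l x x≢0)))

  x*y≡0⇒y≡0 : ∀ {x y} → x ≢ 0# → x * y ≡ 0# → y ≡ 0#
  x*y≡0⇒y≡0 {x} {y} x≢0 xy≡0 = begin
    y                      ≡⟨ sym (*-identityˡ y) ⟩
    1# * y                 ≡⟨ cong (_* y) (sym (inv-l x x≢0)) ⟩
    inv x x≢0 * x * y      ≡⟨ *-assoc _ x y ⟩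
    inv x x≢0 * (x * y)    ≡⟨ cong (inv x x≢0 *_) xy≡0 ⟩
    inv x x≢0 * 0#         ≡⟨ zeroʳ _ ⟩
    0#                     ∎
    where open ≡-Reasoning

  *-nonzero : ∀ {x y} → x ≢ 0# → y ≢ 0# → x * y ≢ 0#
  *-nonzero x≢0 y≢0 = y≢0 ∘ x*y≡0⇒y≡0 x≢0

  x*x≡0⇒x≡0 : ∀ {x} → x * x ≡ 0# → x ≡ 0#
  x*x≡0⇒x≡0 {x} xx≡0 with x ≟ 0#
  ... | yes x≡0 = x≡0
  ... | no  x≢0 = x*y≡0⇒y≡0 x≢0 xx≡0

  x*inv1≡x : ∀ x (1≢0 : 1# ≢ 0#) → x * inv 1# 1≢0 ≡ x
  x*inv1≡x x 1≢0 = trans (cong (x *_) (trans (sym (*-identityʳ _)) (inv-l 1# 1≢0))) (*-identityʳ x)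

  commutativeRing : CommutativeRing _ _
  commutativeRing = record { isCommutativeRing = isCommutativeRing }

  open GroupProperties (AbelianGroup.group (CommutativeRing.+-abelianGroup commutativeRing))
    using (⁻¹-involutive; ε⁻¹≈ε; inverseˡ-unique)

  -x≡x⇒x≡0 : 1# + 1# ≢ 0# → ∀ {x} → - x ≡ x → x ≡ 0#
  -x≡x⇒x≡0 2≢0 {x} -x≡x = x*y≡0⇒y≡0 2≢0 (begin
    (1# + 1#) * x      ≡⟨ distribʳ x 1# 1# ⟩
    1# * x + 1# * x    ≡⟨ cong₂ _+_ (trans (*-identityˡ x) (sym -x≡x)) (*-identityˡ x) ⟩
    - x + x            ≡⟨ -‿inverseˡ x ⟩
    0#                 ∎)
    where open ≡-Reasoning

  characteristic-two : n ≥ 1 → 1# + 1# ≡ 0#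
  characteristic-two n≥1 with 1# + 1# ≟ 0#
  ... | yes 2≡0 = 2≡0
  ... | no  2≢0 with () ← trans (sym (parity-2^ n n≥1))
                            (involution-uniqueFixedPoint⇒odd size -_ ⁻¹-involutive ε⁻¹≈ε (λ _ → -x≡x⇒x≡0 2≢0))

  Fin↔PG1 : Fin (suc (q K)) ↔ PG1 K
  Fin↔PG1 = mk↔ₛ′ toPG1 fromPG1 (λ { infty → refl ; (fin α) → cong fin (strictlyInverseʳ α) })
                                (λ { zero → refl ; (suc i) → cong suc (strictlyInverseˡ i) })
    where
    open Inverse size
    toPG1 : Fin (suc (q K)) → PG1 K
    toPG1 zero    = infty
    toPG1 (suc i) = fin (from i)
    fromPG1 : PG1 K → Fin (suc (q K))
    fromPG1 infty   = zero
    fromPG1 (fin α) = suc (to α)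

  onConic-irrelevant : ∀ Q P (o o′ : OnConic K Q P) → o ≡ o′
  onConic-irrelevant Q (aff _ _) = Decidable⇒UIP.≡-irrelevant _≟_
  onConic-irrelevant Q (atInf _) = Decidable⇒UIP.≡-irrelevant _≟_
  onConic-irrelevant Q ideal     = Decidable⇒UIP.≡-irrelevant _≟_

  module Characteristic2 (1+1≡0 : 1# + 1# ≡ 0#) where

    x+x≡0 : ∀ x → x + x ≡ 0#
    x+x≡0 x = begin
      x + x              ≡⟨ cong₂ _+_ (sym (*-identityˡ x)) (sym (*-identityˡ x)) ⟩
      1# * x + 1# * x    ≡⟨ sym (distribʳ x 1# 1#) ⟩
      (1# + 1#) * x      ≡⟨ cong (_* x) 1+1≡0 ⟩
      0# * x             ≡⟨ zeroˡ x ⟩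
      0#                 ∎
      where open ≡-Reasoning

    -x≡x : ∀ x → - x ≡ x
    -x≡x x = sym (inverseˡ-unique x x (x+x≡0 x))

    -- Polynomial identities are decided by normalising with coefficients in
    -- GF(2) = (Bool, xor, ∧), which is where 1 + 1 = 0 enters.
    private
      ⟦_⟧₂ : Bool → F
      ⟦ false ⟧₂ = 0#
      ⟦ true  ⟧₂ = 1#

      gf2-morphism : CommutativeRing.rawRing Bool.xor-∧-commutativeRing
                       -Raw-AlmostCommutative⟶ fromCommutativeRing commutativeRing
      gf2-morphism = record
        { ⟦_⟧    = ⟦_⟧₂
        ; +-homo = λ { false _ → sym (+-identityˡ _) ; true false → sym (+-identityʳ _) ; true true → sym 1+1≡0 }
        ; *-homo = λ { false _ → sym (zeroˡ _) ; true false → sym (zeroʳ _) ; true true → sym (*-identityˡ _) }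
        ; -‿homo = λ x → sym (-x≡x ⟦ x ⟧₂)
        ; 0-homo = refl
        ; 1-homo = refl
        }

      gf2-≟ : (x y : Bool) → Maybe (⟦ x ⟧₂ ≡ ⟦ y ⟧₂)
      gf2-≟ x y with x Bool.≟ y
      ... | yes x≡y = just (cong ⟦_⟧₂ x≡y)
      ... | no _    = nothing

    open RingSolver _ _ gf2-morphism gf2-≟ using (Polynomial; solve; _:=_; _:+_; _:*_; :-_; con)

    0ₚ 1ₚ : ∀ {k} → Polynomial k
    0ₚ = con false
    1ₚ = con true

    x+y≡0⇒x≡y : ∀ {x y} → x + y ≡ 0# → x ≡ y
    x+y≡0⇒x≡y {x} {y} x+y≡0 = begin
      x              ≡⟨ solve 2 (λ x y → x := (x :+ y) :+ y) refl x y ⟩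
      (x + y) + y    ≡⟨ cong (_+ y) x+y≡0 ⟩
      0# + y         ≡⟨ +-identityˡ y ⟩
      y              ∎
      where open ≡-Reasoning

    ratio-cong : ∀ {x y x′ y′} (y≢0 : y ≢ 0#) (y′≢0 : y′ ≢ 0#) → x * y′ ≡ x′ * y →
                 x * inv y y≢0 ≡ x′ * inv y′ y′≢0
    ratio-cong {x} {y} {x′} {y′} y≢0 y′≢0 xy′≡x′y = begin
      x * a               ≡⟨ solve 2 (λ x a → x :* a := x :* a :* 1ₚ) refl x a ⟩
      x * a * 1#          ≡⟨ cong (x * a *_) (sym (inv-r y′ y′≢0)) ⟩
      x * a * (y′ * a′)   ≡⟨ solve 4 (λ x a y′ a′ → x :* a :* (y′ :* a′) := (x :* y′) :* a :* a′) refl x a y′ a′ ⟩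
      (x * y′) * a * a′   ≡⟨ cong (λ w → w * a * a′) xy′≡x′y ⟩
      (x′ * y) * a * a′   ≡⟨ solve 4 (λ x′ y a a′ → (x′ :* y) :* a :* a′ := x′ :* a′ :* (y :* a)) refl x′ y a a′ ⟩
      x′ * a′ * (y * a)   ≡⟨ cong (x′ * a′ *_) (inv-r y y≢0) ⟩
      x′ * a′ * 1#        ≡⟨ *-identityʳ _ ⟩
      x′ * a′             ∎
      where
      open ≡-Reasoning
      a = inv y y≢0
      a′ = inv y′ y′≢0

    record RootlessCubic : Set where
      field
        c₂ c₁ c₀ : F
        no-root  : ∀ r → r * r * r + c₂ * r * r + c₁ * r + c₀ ≢ 0#

    F³↔Fin : (F × F × F) ↔ Fin (q K *ℕ (q K *ℕ q K))
    F³↔Fin = ↔-trans (size ×-↔ ↔-trans (size ×-↔ size) (↔-sym *↔×)) (↔-sym *↔×)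

    -- The coefficients of (X + r)(X² + s X + t).
    multiply : F × F × F → F × F × F
    multiply (r , s , t) = r + s , r * s + t , r * t

    multiply-collision : multiply (0# , 1# , 0#) ≡ multiply (1# , 0# , 0#)
    multiply-collision = cong₂ _,_ (solve 0 (0ₚ :+ 1ₚ := 1ₚ :+ 0ₚ) refl)
                           (cong₂ _,_ (solve 0 (0ₚ :* 1ₚ :+ 0ₚ := 1ₚ :* 0ₚ :+ 0ₚ) refl)
                                      (solve 0 (0ₚ :* 0ₚ := 1ₚ :* 0ₚ) refl))

    root⇒factor : ∀ {c₂ c₁ c₀} r → r * r * r + c₂ * r * r + c₁ * r + c₀ ≡ 0# →
                  multiply (r , c₂ + r , c₁ + r * (c₂ + r)) ≡ (c₂ , c₁ , c₀)
    root⇒factor {c₂} {c₁} {c₀} r root = cong₂ _,_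
      (solve 2 (λ r c₂ → r :+ (c₂ :+ r) := c₂) refl r c₂)
      (cong₂ _,_ (solve 3 (λ r c₂ c₁ → r :* (c₂ :+ r) :+ (c₁ :+ r :* (c₂ :+ r)) := c₁) refl r c₂ c₁)
                 (begin
                   r * (c₁ + r * (c₂ + r))                            ≡⟨ solve 4 (λ r c₂ c₁ c₀ →
                       r :* (c₁ :+ r :* (c₂ :+ r)) := (r :* r :* r :+ c₂ :* r :* r :+ c₁ :* r :+ c₀) :+ c₀)
                       refl r c₂ c₁ c₀ ⟩
                   (r * r * r + c₂ * r * r + c₁ * r + c₀) + c₀         ≡⟨ cong (_+ c₀) root ⟩
                   0# + c₀                                            ≡⟨ +-identityˡ c₀ ⟩
                   c₀                                                 ∎))
      where open ≡-Reasoning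

    rootlessCubic : RootlessCubic
    rootlessCubic =
      let (c₂ , c₁ , c₀) , missed = finite-nonInjective⇒nonSurjective F³↔Fin multiply
                                      (0≢1 ∘ cong proj₁) multiply-collision
      in record { c₂ = c₂ ; c₁ = c₁ ; c₀ = c₀ ; no-root = λ r root → missed _ (root⇒factor r root) }

    -- Projective coordinates

    Zero₂ : F × F → Set
    Zero₂ (u , v) = u ≡ 0# × v ≡ 0#

    NonZero₂ : F × F → Set
    NonZero₂ w = ¬ Zero₂ w

    -- The determinant u v′ − u′ v; signs are irrelevant in characteristic 2.
    det₂ : F × F → F × F → F
    det₂ (u , v) (u′ , v′) = u * v′ + u′ * v

    -- Junk value: (0 , 0) is sent to infty.
    point₁ : F × F → PG1 K
    point₁ (u , v) with v ≟ 0#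
    ... | no  v≢0 = fin (u * inv v v≢0)
    ... | yes _   = infty

    coords1-nonZero : ∀ t → NonZero₂ (coords1 K t)
    coords1-nonZero (fin _) (_ , 1≡0) = 1≢0 1≡0
    coords1-nonZero infty   (1≡0 , _) = 1≢0 1≡0

    point₁-coords1 : ∀ t → point₁ (coords1 K t) ≡ t
    point₁-coords1 (fin α) with 1# ≟ 0#
    ... | no  1≢0′ = cong fin (x*inv1≡x α 1≢0′)
    ... | yes 1≡0  = ⊥-elim (1≢0 1≡0)
    point₁-coords1 infty with 0# ≟ 0#
    ... | yes _   = refl
    ... | no  0≢0 = ⊥-elim (0≢0 refl)

    point₁-cong : ∀ {w w′} → NonZero₂ w → NonZero₂ w′ → det₂ w w′ ≡ 0# → point₁ w ≡ point₁ w′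
    point₁-cong {u , v} {u′ , v′} w≢0 w′≢0 det≡0 with v ≟ 0# | v′ ≟ 0#
    ... | no v≢0  | no v′≢0  = cong fin (ratio-cong v≢0 v′≢0 (x+y≡0⇒x≡y det≡0))
    ... | yes refl | no v′≢0 = ⊥-elim (w≢0 (x*y≡0⇒y≡0 v′≢0
                                 (trans (solve 3 (λ u v′ u′ → v′ :* u := u :* v′ :+ u′ :* 0ₚ) refl u v′ u′) det≡0) , refl))
    ... | no v≢0  | yes refl = ⊥-elim (w′≢0 (x*y≡0⇒y≡0 v≢0
                                 (trans (solve 3 (λ u v u′ → v :* u′ := u :* 0ₚ :+ u′ :* v) refl u v u′) det≡0) , refl))
    ... | yes _   | yes _    = refl

    _·₂_ : F → F × F → F × F
    μ ·₂ (u , v) = μ * u , μ * v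

    coords1-point₁ : ∀ {w} → NonZero₂ w → ∃ λ μ → μ ≢ 0# × coords1 K (point₁ w) ≡ μ ·₂ w
    coords1-point₁ {u , v} w≢0 with v ≟ 0#
    ... | no v≢0  = inv v v≢0 , inv≢0 v v≢0 , cong₂ _,_ (*-comm u _) (sym (inv-l v v≢0))
    ... | yes refl = inv u u≢0 , inv≢0 u u≢0 , cong₂ _,_ (sym (inv-l u u≢0)) (sym (zeroʳ _))
      where u≢0 = λ u≡0 → w≢0 (u≡0 , refl)

    distinct⇒det₂≢0 : ∀ {s t} → s ≢ t → det₂ (coords1 K s) (coords1 K t) ≢ 0#
    distinct⇒det₂≢0 {s} {t} s≢t det≡0 = s≢t (begin
      s                   ≡⟨ sym (point₁-coords1 s) ⟩
      point₁ (coords1 K s) ≡⟨ point₁-cong (coords1-nonZero s) (coords1-nonZero t) det≡0 ⟩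
      point₁ (coords1 K t) ≡⟨ point₁-coords1 t ⟩
      t                   ∎)
      where open ≡-Reasoning

    zero₂? : ∀ w → Dec (Zero₂ w)
    zero₂? (u , v) = (u ≟ 0#) ×-dec (v ≟ 0#)

    scaled-zero : ∀ {c w} → NonZero₂ w → Zero₂ (c ·₂ w) → c ≡ 0#
    scaled-zero {c} {u , v} w≢0 (cu≡0 , cv≡0) with u ≟ 0# | v ≟ 0#
    ... | no u≢0  | _       = x*y≡0⇒y≡0 u≢0 (trans (*-comm u c) cu≡0)
    ... | yes _   | no v≢0  = x*y≡0⇒y≡0 v≢0 (trans (*-comm v c) cv≡0)
    ... | yes u≡0 | yes v≡0 = ⊥-elim (w≢0 (u≡0 , v≡0))

    det₂≢0⇒trivialKernel : ∀ {α β α′ β′ A B} → det₂ (α , β) (α′ , β′) ≢ 0# →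
                           α * A + β * B ≡ 0# → α′ * A + β′ * B ≡ 0# → A ≡ 0# × B ≡ 0#
    det₂≢0⇒trivialKernel {α} {β} {α′} {β′} {A} {B} det≢0 e e′ =
      x*y≡0⇒y≡0 det≢0 (trans (solve 6 (λ α β α′ β′ A B →
          (α :* β′ :+ α′ :* β) :* A := β′ :* (α :* A :+ β :* B) :+ β :* (α′ :* A :+ β′ :* B))
          refl α β α′ β′ A B) (vanish β′ β)) ,
      x*y≡0⇒y≡0 det≢0 (trans (solve 6 (λ α β α′ β′ A B →
          (α :* β′ :+ α′ :* β) :* B := α′ :* (α :* A :+ β :* B) :+ α :* (α′ :* A :+ β′ :* B))
          refl α β α′ β′ A B) (vanish α′ α))
      where
      vanish : ∀ c c′ → c * (α * A + β * B) + c′ * (α′ * A + β′ * B) ≡ 0#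
      vanish c c′ = trans (cong₂ (λ x y → c * x + c′ * y) e e′)
                          (solve 2 (λ c c′ → c :* 0ₚ :+ c′ :* 0ₚ := 0ₚ) refl c c′)

    NonZero₃ : F × F × F → Set
    NonZero₃ v = v ≢ (0# , 0# , 0#)

    _·₃_ : F → F × F × F → F × F × F
    κ ·₃ (x , y , z) = κ * x , κ * y , κ * z

    -- Junk value: (0 , 0 , 0) is sent to ideal.
    point₂ : F × F × F → PG2 K
    point₂ (x , y , z) with z ≟ 0# | y ≟ 0#
    ... | no  z≢0 | _       = aff (x * inv z z≢0) (y * inv z z≢0)
    ... | yes _   | no  y≢0 = atInf (x * inv y y≢0)
    ... | yes _   | yes _   = ideal

    coords-point₂ : ∀ {v} → NonZero₃ v → ∃ λ κ → κ ≢ 0# × coords K (point₂ v) ≡ κ ·₃ v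
    coords-point₂ {x , y , z} v≢0 with z ≟ 0# | y ≟ 0#
    ... | no  z≢0  | _        = inv z z≢0 , inv≢0 z z≢0 ,
                                cong₂ _,_ (*-comm x _) (cong₂ _,_ (*-comm y _) (sym (inv-l z z≢0)))
    ... | yes refl | no  y≢0  = inv y y≢0 , inv≢0 y y≢0 ,
                                cong₂ _,_ (*-comm x _) (cong₂ _,_ (sym (inv-l y y≢0)) (sym (zeroʳ _)))
    ... | yes refl | yes refl = inv x x≢0 , inv≢0 x x≢0 ,
                                cong₂ _,_ (sym (inv-l x x≢0)) (cong₂ _,_ (sym (zeroʳ _)) (sym (zeroʳ _)))
      where x≢0 = λ x≡0 → v≢0 (cong (_, 0# , 0#) x≡0)

    point₂-scaled-coords : ∀ {κ} → κ ≢ 0# → ∀ P → point₂ (κ ·₃ coords K P) ≡ P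
    point₂-scaled-coords {κ} κ≢0 (aff x y) with κ * 1# ≟ 0# | κ * y ≟ 0#
    ... | no κ1≢0 | _ = cong₂ aff (unscale x) (unscale y)
      where
      unscale : ∀ x → κ * x * inv (κ * 1#) κ1≢0 ≡ x
      unscale x = trans (ratio-cong κ1≢0 1≢0 (solve 2 (λ κ x → κ :* x :* 1ₚ := x :* (κ :* 1ₚ)) refl κ x))
                        (x*inv1≡x x 1≢0)
    ... | yes κ1≡0 | _ = ⊥-elim (κ≢0 (trans (sym (*-identityʳ κ)) κ1≡0))
    point₂-scaled-coords {κ} κ≢0 (atInf x) with κ * 0# ≟ 0# | κ * 1# ≟ 0#
    ... | no κ0≢0 | _       = ⊥-elim (κ0≢0 (zeroʳ κ))
    ... | yes _   | no κ1≢0 = cong atInf (trans (ratio-cong κ1≢0 1≢0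
                                (solve 2 (λ κ x → κ :* x :* 1ₚ := x :* (κ :* 1ₚ)) refl κ x)) (x*inv1≡x x 1≢0))
    ... | yes _   | yes κ1≡0 = ⊥-elim (κ≢0 (trans (sym (*-identityʳ κ)) κ1≡0))
    point₂-scaled-coords {κ} κ≢0 ideal with κ * 0# ≟ 0# | κ * 0# ≟ 0#
    ... | no κ0≢0 | _       = ⊥-elim (κ0≢0 (zeroʳ κ))
    ... | yes _   | no κ0≢0 = ⊥-elim (κ0≢0 (zeroʳ κ))
    ... | yes _   | yes _   = refl

    xy : F × F × F → F × F
    xy (x , y , _) = x , y

    origin-unique : ∀ P → Zero₂ (xy (coords K P)) → P ≡ aff 0# 0#
    origin-unique (aff _ _) (refl , refl) = refl
    origin-unique (atInf _) (_ , 1≡0)    = ⊥-elim (1≢0 1≡0)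
    origin-unique ideal     (1≡0 , _)    = ⊥-elim (1≢0 1≡0)

    evalAt : QForm K → F × F × F → F
    evalAt Q (x , y , z) = eval K Q x y z

    onConic→ : ∀ {Q} P → OnConic K Q P → evalAt Q (coords K P) ≡ 0#
    onConic→ (aff _ _) o = o
    onConic→ (atInf _) o = o
    onConic→ ideal     o = o

    onConic← : ∀ {Q} P → evalAt Q (coords K P) ≡ 0# → OnConic K Q P
    onConic← (aff _ _) o = o
    onConic← (atInf _) o = o
    onConic← ideal     o = o

    evalAt-scale : ∀ Q κ v → evalAt Q (κ ·₃ v) ≡ κ * κ * evalAt Q v
    evalAt-scale (qform a b c f g h) κ (x , y , z) = solve 10 (λ a b c f g h κ x y z →
      a :* (κ :* x) :* (κ :* x) :+ b :* (κ :* y) :* (κ :* y) :+ c :* (κ :* z) :* (κ :* z)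
        :+ f :* (κ :* y) :* (κ :* z) :+ g :* (κ :* z) :* (κ :* x) :+ h :* (κ :* x) :* (κ :* y)
      := κ :* κ :* (a :* x :* x :+ b :* y :* y :+ c :* z :* z :+ f :* y :* z :+ g :* z :* x :+ h :* x :* y))
      refl a b c f g h κ x y z

    private
      det : ∀ {k} → (a₁ a₂ a₃ b₁ b₂ b₃ c₁ c₂ c₃ : Polynomial k) → Polynomial k
      det a₁ a₂ a₃ b₁ b₂ b₃ c₁ c₂ c₃ =
        a₁ :* (b₂ :* c₃ :+ :- (b₃ :* c₂)) :+ :- (a₂ :* (b₁ :* c₃ :+ :- (b₃ :* c₁)))
          :+ a₃ :* (b₁ :* c₂ :+ :- (b₂ :* c₁))

    det3-scale : ∀ α β γ u v w → det3 K (α ·₃ u) (β ·₃ v) (γ ·₃ w) ≡ α * β * γ * det3 K u v w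
    det3-scale α β γ (u₁ , u₂ , u₃) (v₁ , v₂ , v₃) (w₁ , w₂ , w₃) =
      solve 12 (λ α β γ u₁ u₂ u₃ v₁ v₂ v₃ w₁ w₂ w₃ →
        det (α :* u₁) (α :* u₂) (α :* u₃) (β :* v₁) (β :* v₂) (β :* v₃) (γ :* w₁) (γ :* w₂) (γ :* w₃)
        := α :* β :* γ :* det u₁ u₂ u₃ v₁ v₂ v₃ w₁ w₂ w₃)
        refl α β γ u₁ u₂ u₃ v₁ v₂ v₃ w₁ w₂ w₃

    ·₃-assoc : ∀ α β v → α ·₃ (β ·₃ v) ≡ (α * β) ·₃ v
    ·₃-assoc α β (x , y , z) = cong₂ _,_ (sym (*-assoc α β x)) (cong₂ _,_ (sym (*-assoc α β y)) (sym (*-assoc α β z)))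

    -- Conics through (0:0:1)

    module Conic (a b f g : F) (nondegenerate : a * f * f + b * g * g ≢ 0#) where

      Q : QForm K
      Q = qform a b 0# f g 0#

      L M : F × F → F
      L (u , v) = g * u + f * v
      M (u , v) = a * u * u + b * v * v

      private
        Lₚ Mₚ : ∀ {k} → Polynomial k → Polynomial k → Polynomial k → Polynomial k → Polynomial k
        Lₚ g f u v = g :* u :+ f :* v
        Mₚ a b u v = a :* u :* u :+ b :* v :* v

        evalₚ : ∀ {k} → (a b f g x y z : Polynomial k) → Polynomial k
        evalₚ a b f g x y z =
          a :* x :* x :+ b :* y :* y :+ 0ₚ :* z :* z :+ f :* y :* z :+ g :* z :* x :+ 0ₚ :* x :* y

      M≡0⇒L≡0⇒Zero₂ : ∀ {w} → M w ≡ 0# → L w ≡ 0# → Zero₂ w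
      M≡0⇒L≡0⇒Zero₂ {u , v} M≡0 L≡0 =
          x*x≡0⇒x≡0 (x*y≡0⇒y≡0 nondegenerate (trans (solve 6 (λ a b f g u v →
            (a :* f :* f :+ b :* g :* g) :* (u :* u)
              := f :* f :* Mₚ a b u v :+ b :* Lₚ g f u v :* Lₚ g f u v)
            refl a b f g u v) (vanish (f * f) b)))
        , x*x≡0⇒x≡0 (x*y≡0⇒y≡0 nondegenerate (trans (solve 6 (λ a b f g u v →
            (a :* f :* f :+ b :* g :* g) :* (v :* v)
              := g :* g :* Mₚ a b u v :+ a :* Lₚ g f u v :* Lₚ g f u v)
            refl a b f g u v) (vanish (g * g) a)))
        where
        vanish : ∀ c d → c * M (u , v) + d * L (u , v) * L (u , v) ≡ 0#
        vanish c d = trans (cong₂ (λ m l → c * m + d * l * l) M≡0 L≡0)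
                           (solve 2 (λ c d → c :* 0ₚ :+ d :* 0ₚ :* 0ₚ := 0ₚ) refl c d)

      fg-nonZero : NonZero₂ (f , g)
      fg-nonZero (f≡0 , g≡0) = nondegenerate (trans (cong₂ (λ f g → a * f * f + b * g * g) f≡0 g≡0)
                                 (solve 2 (λ a b → a :* 0ₚ :* 0ₚ :+ b :* 0ₚ :* 0ₚ := 0ₚ) refl a b))

      -- The line through (0:0:1) in direction (u:v) meets Q again in (L u : L v : M).
      param : F × F → F × F × F
      param w@(u , v) = L w * u , L w * v , M w

      param-nonZero : ∀ {w} → NonZero₂ w → NonZero₃ (param w)
      param-nonZero {w} w≢0 param≡0 with L w ≟ 0#
      ... | yes L≡0 = w≢0 (M≡0⇒L≡0⇒Zero₂ (cong (proj₂ ∘ proj₂) param≡0) L≡0)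
      ... | no  L≢0 = w≢0 ( x*y≡0⇒y≡0 L≢0 (cong proj₁ param≡0)
                          , x*y≡0⇒y≡0 L≢0 (cong (proj₁ ∘ proj₂) param≡0))

      param-onConic : ∀ w → evalAt Q (param w) ≡ 0#
      param-onConic (u , v) = solve 6 (λ a b f g u v →
        evalₚ a b f g (Lₚ g f u v :* u) (Lₚ g f u v :* v) (Mₚ a b u v) := 0ₚ) refl a b f g u v

      param-scale : ∀ μ w → param (μ ·₂ w) ≡ (μ * μ) ·₃ param w
      param-scale μ (u , v) = cong₂ _,_ (scaleL u) (cong₂ _,_ (scaleL v)
        (solve 5 (λ a b μ u v → Mₚ a b (μ :* u) (μ :* v) := μ :* μ :* Mₚ a b u v) refl a b μ u v))
        where
        scaleL : ∀ x → L (μ ·₂ (u , v)) * (μ * x) ≡ μ * μ * (L (u , v) * x)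
        scaleL x = solve 6 (λ f g μ u v x → Lₚ g f (μ :* u) (μ :* v) :* (μ :* x) := μ :* μ :* (Lₚ g f u v :* x))
                     refl f g μ u v x

      det-param : ∀ w₁ w₂ w₃ → det3 K (param w₁) (param w₂) (param w₃)
                               ≡ (a * f * f + b * g * g) * (det₂ w₁ w₂ * det₂ w₁ w₃ * det₂ w₂ w₃)
      det-param (u₁ , v₁) (u₂ , v₂) (u₃ , v₃) = solve 10 (λ a b f g u₁ v₁ u₂ v₂ u₃ v₃ →
        det (Lₚ g f u₁ v₁ :* u₁) (Lₚ g f u₁ v₁ :* v₁) (Mₚ a b u₁ v₁)
            (Lₚ g f u₂ v₂ :* u₂) (Lₚ g f u₂ v₂ :* v₂) (Mₚ a b u₂ v₂)
            (Lₚ g f u₃ v₃ :* u₃) (Lₚ g f u₃ v₃ :* v₃) (Mₚ a b u₃ v₃)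
        := (a :* f :* f :+ b :* g :* g)
             :* ((u₁ :* v₂ :+ u₂ :* v₁) :* (u₁ :* v₃ :+ u₃ :* v₁) :* (u₂ :* v₃ :+ u₃ :* v₂)))
        refl a b f g u₁ v₁ u₂ v₂ u₃ v₃

      param-onConic-xy : ∀ v → evalAt Q v ≡ 0# → param (xy v) ≡ L (xy v) ·₃ v
      param-onConic-xy (x , y , z) onQ = cong (λ m → L (x , y) * x , L (x , y) * y , m)
        (x+y≡0⇒x≡y (trans (solve 7 (λ a b f g x y z →
          Mₚ a b x y :+ Lₚ g f x y :* z := evalₚ a b f g x y z) refl a b f g x y z) onQ))

      param-fg : param (f , g) ≡ M (f , g) ·₃ (0# , 0# , 1#)
      param-fg = cong₂ _,_ (vanish f) (cong₂ _,_ (vanish g) (solve 1 (λ m → m := m :* 1ₚ) refl (M (f , g))))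
        where
        vanish : ∀ x → L (f , g) * x ≡ M (f , g) * 0#
        vanish x = solve 5 (λ a b f g x → Lₚ g f f g :* x := Mₚ a b f g :* 0ₚ) refl a b f g x

      point : PG1 K → PG2 K
      point t = point₂ (param (coords1 K t))

      coords-point : ∀ t → ∃ λ κ → κ ≢ 0# × coords K (point t) ≡ κ ·₃ param (coords1 K t)
      coords-point t = coords-point₂ (param-nonZero (coords1-nonZero t))

      point-onConic : ∀ t → OnConic K Q (point t)
      point-onConic t = onConic← (point t) (begin
        evalAt Q (coords K (point t))  ≡⟨ cong (evalAt Q) coords≡ ⟩
        evalAt Q (κ ·₃ param w)        ≡⟨ evalAt-scale Q κ (param w) ⟩
        κ * κ * evalAt Q (param w)     ≡⟨ cong (κ * κ *_) (param-onConic w) ⟩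
        κ * κ * 0#                     ≡⟨ zeroʳ _ ⟩
        0#                             ∎)
        where
        open ≡-Reasoning
        w = coords1 K t
        κ = proj₁ (coords-point t)
        coords≡ = proj₂ (proj₂ (coords-point t))

      -- (0:0:1) itself corresponds to the tangent direction (f:g) there, the zero of L.
      direction : F × F → F × F
      direction w with zero₂? w
      ... | yes _ = f , g
      ... | no  _ = w

      project : PG2 K → PG1 K
      project P = point₁ (direction (xy (coords K P)))

      project-point : ∀ t → project (point t) ≡ t
      project-point t = begin
        project (point t)                                    ≡⟨ cong (point₁ ∘ direction ∘ xy) coords≡ ⟩
        point₁ (direction (xy (κ ·₃ param (coords1 K t))))  ≡⟨ direction-param (coords1-nonZero t) ⟩
        point₁ (coords1 K t)                                 ≡⟨ point₁-coords1 t ⟩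
        t                                                    ∎
        where
        open ≡-Reasoning
        κ = proj₁ (coords-point t)
        κ≢0 = proj₁ (proj₂ (coords-point t))
        coords≡ = proj₂ (proj₂ (coords-point t))
        direction-param : ∀ {w} → NonZero₂ w → point₁ (direction (xy (κ ·₃ param w))) ≡ point₁ w
        direction-param {w@(u , v)} w≢0 with zero₂? (xy (κ ·₃ param w))
        ... | no ≢0 = point₁-cong ≢0 w≢0
          (solve 4 (λ κ l u v → κ :* (l :* u) :* v :+ u :* (κ :* (l :* v)) := 0ₚ) refl κ (L w) u v)
        ... | yes (≡0₁ , ≡0₂) = point₁-cong fg-nonZero w≢0
          (trans (solve 4 (λ f g u v → f :* v :+ u :* g := Lₚ g f u v) refl f g u v) L≡0)
          where
          κL≡0 = scaled-zero {c = κ * L w} w≢0 (trans (*-assoc κ (L w) u) ≡0₁ , trans (*-assoc κ (L w) v) ≡0₂)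
          L≡0 = x*y≡0⇒y≡0 κ≢0 κL≡0

      L-fg≡0 : L (f , g) ≡ 0#
      L-fg≡0 = solve 2 (λ f g → Lₚ g f f g := 0ₚ) refl f g

      param-project : ∀ P → OnConic K Q P → ∃ λ κ → κ ≢ 0# × param (coords1 K (project P)) ≡ κ ·₃ coords K P
      param-project P onQ with zero₂? (xy (coords K P))
      ... | no w≢0 = μ * μ * L w , *-nonzero (*-nonzero μ≢0 μ≢0) L≢0 , (begin
        param (coords1 K (point₁ w))    ≡⟨ cong param coords1≡ ⟩
        param (μ ·₂ w)                  ≡⟨ param-scale μ w ⟩
        (μ * μ) ·₃ param w              ≡⟨ cong ((μ * μ) ·₃_) param≡ ⟩
        (μ * μ) ·₃ (L w ·₃ coords K P)  ≡⟨ ·₃-assoc (μ * μ) (L w) (coords K P) ⟩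
        (μ * μ * L w) ·₃ coords K P     ∎)
        where
        open ≡-Reasoning
        w = xy (coords K P)
        μ = proj₁ (coords1-point₁ w≢0)
        μ≢0 = proj₁ (proj₂ (coords1-point₁ w≢0))
        coords1≡ = proj₂ (proj₂ (coords1-point₁ w≢0))
        param≡ = param-onConic-xy (coords K P) (onConic→ P onQ)
        L≢0 : L w ≢ 0#
        L≢0 L≡0 = w≢0 (M≡0⇒L≡0⇒Zero₂ (trans (cong (proj₂ ∘ proj₂) param≡)
                                         (trans (cong (_* proj₂ (proj₂ (coords K P))) L≡0) (zeroˡ _))) L≡0)
      ... | yes w≡0 with refl ← origin-unique P w≡0 =
        μ * μ * M (f , g) , *-nonzero (*-nonzero μ≢0 μ≢0) M≢0 , (begin
        param (coords1 K (point₁ (f , g)))        ≡⟨ cong param coords1≡ ⟩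
        param (μ ·₂ (f , g))                      ≡⟨ param-scale μ (f , g) ⟩
        (μ * μ) ·₃ param (f , g)                  ≡⟨ cong ((μ * μ) ·₃_) param-fg ⟩
        (μ * μ) ·₃ (M (f , g) ·₃ (0# , 0# , 1#))  ≡⟨ ·₃-assoc (μ * μ) (M (f , g)) _ ⟩
        (μ * μ * M (f , g)) ·₃ (0# , 0# , 1#)     ∎)
        where
        open ≡-Reasoning
        μ = proj₁ (coords1-point₁ fg-nonZero)
        μ≢0 = proj₁ (proj₂ (coords1-point₁ fg-nonZero))
        coords1≡ = proj₂ (proj₂ (coords1-point₁ fg-nonZero))
        M≢0 : M (f , g) ≢ 0#
        M≢0 M≡0 = fg-nonZero (M≡0⇒L≡0⇒Zero₂ M≡0 L-fg≡0)

      point-project : ∀ P → OnConic K Q P → point (project P) ≡ P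
      point-project P onQ =
        let κ , κ≢0 , param≡ = param-project P onQ
        in trans (cong point₂ param≡) (point₂-scaled-coords κ≢0 P)

      coords-onConic : ∀ P → OnConic K Q P → ∃ λ κ → κ ≢ 0# × coords K P ≡ κ ·₃ param (coords1 K (project P))
      coords-onConic P onQ = subst (λ X → ∃ λ κ → κ ≢ 0# × coords K X ≡ κ ·₃ param (coords1 K (project P)))
                                   (point-project P onQ) (coords-point (project P))

      project-injective : ∀ {P P′} → OnConic K Q P → OnConic K Q P′ → project P ≡ project P′ → P ≡ P′
      project-injective {P} {P′} onP onP′ eq =
        trans (sym (point-project P onP)) (trans (cong point eq) (point-project P′ onP′))

      noThreeCollinear : (P₁ P₂ P₃ : PG2 K) → OnConic K Q P₁ → OnConic K Q P₂ → OnConic K Q P₃ →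
                         P₁ ≢ P₂ → P₂ ≢ P₃ → P₁ ≢ P₃ → ¬ Collinear K P₁ P₂ P₃
      noThreeCollinear P₁ P₂ P₃ on₁ on₂ on₃ P₁≢P₂ P₂≢P₃ P₁≢P₃ collinear =
        *-nonzero (*-nonzero (*-nonzero κ₁≢0 κ₂≢0) κ₃≢0)
                  (*-nonzero nondegenerate (*-nonzero (*-nonzero (apart P₁≢P₂ on₁ on₂) (apart P₁≢P₃ on₁ on₃))
                                                      (apart P₂≢P₃ on₂ on₃)))
          (begin
            κ₁ * κ₂ * κ₃ * ((a * f * f + b * g * g) * (det₂ w₁ w₂ * det₂ w₁ w₃ * det₂ w₂ w₃))
              ≡⟨ cong (κ₁ * κ₂ * κ₃ *_) (sym (det-param w₁ w₂ w₃)) ⟩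
            κ₁ * κ₂ * κ₃ * det3 K (param w₁) (param w₂) (param w₃)
              ≡⟨ sym (det3-scale κ₁ κ₂ κ₃ (param w₁) (param w₂) (param w₃)) ⟩
            det3 K (κ₁ ·₃ param w₁) (κ₂ ·₃ param w₂) (κ₃ ·₃ param w₃)
              ≡⟨ sym (cong₂ (λ u → uncurry (det3 K u)) e₁ (cong₂ _,_ e₂ e₃)) ⟩
            det3 K (coords K P₁) (coords K P₂) (coords K P₃)
              ≡⟨ collinear ⟩
            0# ∎)
        where
        open ≡-Reasoning
        w₁ = coords1 K (project P₁)
        w₂ = coords1 K (project P₂)
        w₃ = coords1 K (project P₃)
        κ₁ = proj₁ (coords-onConic P₁ on₁)
        κ₂ = proj₁ (coords-onConic P₂ on₂)
        κ₃ = proj₁ (coords-onConic P₃ on₃)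
        κ₁≢0 = proj₁ (proj₂ (coords-onConic P₁ on₁))
        κ₂≢0 = proj₁ (proj₂ (coords-onConic P₂ on₂))
        κ₃≢0 = proj₁ (proj₂ (coords-onConic P₃ on₃))
        e₁ = proj₂ (proj₂ (coords-onConic P₁ on₁))
        e₂ = proj₂ (proj₂ (coords-onConic P₂ on₂))
        e₃ = proj₂ (proj₂ (coords-onConic P₃ on₃))
        apart : ∀ {P P′} → P ≢ P′ → OnConic K Q P → OnConic K Q P′ →
                det₂ (coords1 K (project P)) (coords1 K (project P′)) ≢ 0#
        apart P≢P′ onP onP′ = distinct⇒det₂≢0 (P≢P′ ∘ project-injective onP onP′)

      PG1↔conic : PG1 K ↔ Σ (PG2 K) (OnConic K Q)
      PG1↔conic = mk↔ₛ′ (λ t → point t , point-onConic t) (project ∘ proj₁)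
                        (λ (P , onQ) → Σ-≡,≡→≡ (point-project P onQ , onConic-irrelevant Q P _ onQ))
                        project-point

      translation : ∀ x₀ y₀ x₁ y₁ → OnConic K Q (aff x₀ y₀) → OnConic K Q (aff x₁ y₁) →
                    OnConic K Q (aff (x₀ + x₁) (y₀ + y₁))
      translation x₀ y₀ x₁ y₁ on₀ on₁ = begin
        eval K Q (x₀ + x₁) (y₀ + y₁) 1#           ≡⟨ solve 8 (λ a b f g x₀ y₀ x₁ y₁ →
            evalₚ a b f g (x₀ :+ x₁) (y₀ :+ y₁) 1ₚ := evalₚ a b f g x₀ y₀ 1ₚ :+ evalₚ a b f g x₁ y₁ 1ₚ)
            refl a b f g x₀ y₀ x₁ y₁ ⟩
        eval K Q x₀ y₀ 1# + eval K Q x₁ y₁ 1#    ≡⟨ cong₂ _+_ on₀ on₁ ⟩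
        0# + 0#                                  ≡⟨ +-identityˡ 0# ⟩
        0#                                       ∎
        where open ≡-Reasoning

      nonSingular : NonSingular K Q
      nonSingular Δ≡0 = nondegenerate (trans (solve 4 (λ a b f g →
        a :* f :* f :+ b :* g :* g
          := (1ₚ :+ 1ₚ :+ 1ₚ :+ 1ₚ) :* a :* b :* 0ₚ :+ :- (a :* f :* f) :+ :- (b :* g :* g)
               :+ :- (0ₚ :* 0ₚ :* 0ₚ) :+ f :* g :* 0ₚ) refl a b f g) Δ≡0)

      translationOval : IsTranslationOval K (OnConic K Q)
      translationOval = (↔-trans Fin↔PG1 PG1↔conic , noThreeCollinear) , translation

    -- The pencil

    module Pencil (C : RootlessCubic) where
      open RootlessCubic C

      φ χ : QForm K
      φ = qform 1# c₁ 0# 1# 0# 0#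
      χ = qform c₂ c₀ 0# 0# 1# 0#

      binaryCubic : F × F → F
      binaryCubic (x , y) = x * x * x + c₂ * x * x * y + c₁ * x * y * y + c₀ * y * y * y

      binaryCubic≡0⇒Zero₂ : ∀ {w} → binaryCubic w ≡ 0# → Zero₂ w
      binaryCubic≡0⇒Zero₂ {x , y} B≡0 with y ≟ 0#
      ... | yes refl = x*x≡0⇒x≡0 (cube≡0⇒square≡0 (trans (solve 4 (λ x c₂ c₁ c₀ →
                         x :* x :* x := x :* x :* x :+ c₂ :* x :* x :* 0ₚ :+ c₁ :* x :* 0ₚ :* 0ₚ :+ c₀ :* 0ₚ :* 0ₚ :* 0ₚ)
                         refl x c₂ c₁ c₀) B≡0)) , refl
        where
        cube≡0⇒square≡0 : x * x * x ≡ 0# → x * x ≡ 0#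
        cube≡0⇒square≡0 xxx≡0 with x ≟ 0#
        ... | yes x≡0 = trans (cong (_* x) x≡0) (zeroˡ x)
        ... | no  x≢0 = x*y≡0⇒y≡0 x≢0 (trans (*-comm x _) xxx≡0)
      ... | no y≢0 = ⊥-elim (no-root (x * w) (x*y≡0⇒y≡0 y³≢0 (begin
        y * y * y * cubic (x * w)      ≡⟨ solve 6 (λ x y w c₂ c₁ c₀ → y :* y :* y :* cubicₚ c₂ c₁ c₀ (x :* w)
                                             := x :* x :* x :* (w :* y :* (w :* y) :* (w :* y))
                                                :+ c₂ :* x :* x :* y :* (w :* y :* (w :* y))
                                                :+ c₁ :* x :* y :* y :* (w :* y) :+ c₀ :* y :* y :* y)
                                             refl x y w c₂ c₁ c₀ ⟩
        scaled (w * y)                 ≡⟨ cong scaled (inv-l y y≢0) ⟩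
        scaled 1#                      ≡⟨ solve 5 (λ x y c₂ c₁ c₀ → x :* x :* x :* (1ₚ :* 1ₚ :* 1ₚ)
                                                :+ c₂ :* x :* x :* y :* (1ₚ :* 1ₚ)
                                                :+ c₁ :* x :* y :* y :* 1ₚ :+ c₀ :* y :* y :* y
                                             := x :* x :* x :+ c₂ :* x :* x :* y :+ c₁ :* x :* y :* y :+ c₀ :* y :* y :* y)
                                             refl x y c₂ c₁ c₀ ⟩
        binaryCubic (x , y)            ≡⟨ B≡0 ⟩
        0#                             ∎)))
        where
        open ≡-Reasoning
        w = inv y y≢0
        y³≢0 = *-nonzero (*-nonzero y≢0 y≢0) y≢0
        cubic : F → F
        cubic r = r * r * r + c₂ * r * r + c₁ * r + c₀
        cubicₚ : ∀ {k} → (c₂ c₁ c₀ r : Polynomial k) → Polynomial k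
        cubicₚ c₂ c₁ c₀ r = r :* r :* r :+ c₂ :* r :* r :+ c₁ :* r :+ c₀
        scaled : F → F
        scaled s = x * x * x * (s * s * s) + c₂ * x * x * y * (s * s) + c₁ * x * y * y * s + c₀ * y * y * y

      conicAt : F × F → QForm K
      conicAt (α , β) = qform (α + β * c₂) (α * c₁ + β * c₀) 0# α β 0#

      lin≡conicAt : ∀ α β → lin K α φ β χ ≡ conicAt (α , β)
      lin≡conicAt α β = qform-cong
        (solve 3 (λ α β c₂ → α :* 1ₚ :+ β :* c₂ := α :+ β :* c₂) refl α β c₂) refl
        (vanish α β) (solve 2 (λ α β → α :* 1ₚ :+ β :* 0ₚ := α) refl α β)
        (solve 2 (λ α β → α :* 0ₚ :+ β :* 1ₚ := β) refl α β) (vanish α β)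
        where
        vanish : ∀ α β → α * 0# + β * 0# ≡ 0#
        vanish = solve 2 (λ α β → α :* 0ₚ :+ β :* 0ₚ := 0ₚ) refl
        qform-cong : ∀ {a a′ b b′ c c′ f f′ g g′ h h′} → a ≡ a′ → b ≡ b′ → c ≡ c′ → f ≡ f′ → g ≡ g′ → h ≡ h′ →
                     _≡_ {A = QForm K} (qform a b c f g h) (qform a′ b′ c′ f′ g′ h′)
        qform-cong refl refl refl refl refl refl = refl

      member≡conicAt : ∀ t → Member K φ χ t ≡ conicAt (coords1 K t)
      member≡conicAt (fin α) = lin≡conicAt α 1#
      member≡conicAt infty   = lin≡conicAt 1# 0#

      member-translationOval : ∀ t → NonSingular K (Member K φ χ t) × IsTranslationOval K (OnConic K (Member K φ χ t))
      member-translationOval t = subst (λ Q → NonSingular K Q × IsTranslationOval K (OnConic K Q))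
        (sym (member≡conicAt t)) (nonSingular , translationOval)
        where
        α = proj₁ (coords1 K t)
        β = proj₂ (coords1 K t)
        nondegenerate : (α + β * c₂) * α * α + (α * c₁ + β * c₀) * β * β ≢ 0#
        nondegenerate B≡0 = coords1-nonZero t (binaryCubic≡0⇒Zero₂ (trans (solve 5 (λ α β c₂ c₁ c₀ →
          α :* α :* α :+ c₂ :* α :* α :* β :+ c₁ :* α :* β :* β :+ c₀ :* β :* β :* β
            := (α :+ β :* c₂) :* α :* α :+ (α :* c₁ :+ β :* c₀) :* β :* β) refl α β c₂ c₁ c₀) B≡0))
        open Conic (α + β * c₂) (α * c₁ + β * c₀) α β nondegenerate using (nonSingular; translationOval)

      evalAt-conicAt : ∀ w v → evalAt (conicAt w) v ≡ proj₁ w * evalAt φ v + proj₂ w * evalAt χ v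
      evalAt-conicAt (α , β) (x , y , z) = solve 8 (λ α β c₂ c₁ c₀ x y z →
        (α :+ β :* c₂) :* x :* x :+ (α :* c₁ :+ β :* c₀) :* y :* y :+ 0ₚ :* z :* z :+ α :* y :* z
          :+ β :* z :* x :+ 0ₚ :* x :* y
        := α :* (1ₚ :* x :* x :+ c₁ :* y :* y :+ 0ₚ :* z :* z :+ 1ₚ :* y :* z :+ 0ₚ :* z :* x :+ 0ₚ :* x :* y)
           :+ β :* (c₂ :* x :* x :+ c₀ :* y :* y :+ 0ₚ :* z :* z :+ 0ₚ :* y :* z :+ 1ₚ :* z :* x :+ 0ₚ :* x :* y))
        refl α β c₂ c₁ c₀ x y z

      binaryCubic-combination : ∀ v → proj₁ v * evalAt φ v + proj₁ (proj₂ v) * evalAt χ v ≡ binaryCubic (xy v)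
      binaryCubic-combination (x , y , z) = solve 6 (λ c₂ c₁ c₀ x y z →
        x :* (1ₚ :* x :* x :+ c₁ :* y :* y :+ 0ₚ :* z :* z :+ 1ₚ :* y :* z :+ 0ₚ :* z :* x :+ 0ₚ :* x :* y)
          :+ y :* (c₂ :* x :* x :+ c₀ :* y :* y :+ 0ₚ :* z :* z :+ 0ₚ :* y :* z :+ 1ₚ :* z :* x :+ 0ₚ :* x :* y)
        := x :* x :* x :+ c₂ :* x :* x :* y :+ c₁ :* x :* y :* y :+ c₀ :* y :* y :* y)
        refl c₂ c₁ c₀ x y z

      trivialIntersection : (s t : PG1 K) → s ≢ t → (P : PG2 K) →
                            OnConic K (Member K φ χ s) P × OnConic K (Member K φ χ t) P → P ≡ aff 0# 0#
      trivialIntersection s t s≢t P (onS , onT) = origin-unique P (binaryCubic≡0⇒Zero₂ (begin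
        binaryCubic (xy v)                                      ≡⟨ sym (binaryCubic-combination v) ⟩
        proj₁ v * evalAt φ v + proj₁ (proj₂ v) * evalAt χ v     ≡⟨ cong₂ (λ A B → proj₁ v * A + proj₁ (proj₂ v) * B)
                                                                         (proj₁ φχ≡0) (proj₂ φχ≡0) ⟩
        proj₁ v * 0# + proj₁ (proj₂ v) * 0#                     ≡⟨ solve 2 (λ x y → x :* 0ₚ :+ y :* 0ₚ := 0ₚ)
                                                                         refl (proj₁ v) (proj₁ (proj₂ v)) ⟩
        0#                                                      ∎))
        where
        open ≡-Reasoning
        v = coords K P
        onMember : ∀ u → OnConic K (Member K φ χ u) P →
                   proj₁ (coords1 K u) * evalAt φ v + proj₂ (coords1 K u) * evalAt χ v ≡ 0#
        onMember u onU = trans (sym (evalAt-conicAt (coords1 K u) v))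
                               (subst (λ Q → evalAt Q v ≡ 0#) (member≡conicAt u) (onConic→ P onU))
        φχ≡0 = det₂≢0⇒trivialKernel (distinct⇒det₂≢0 s≢t) (onMember s onS) (onMember t onT)

      tiPencil : TIPencil K
      tiPencil = φ , χ , member-translationOval , trivialIntersection

corollary3p4 : (n : ℕ) → n ≥ 1 → (K : GF2^ n) → TIPencil K
corollary3p4 n n≥1 K = tiPencil
  where
  open Field K
  open Characteristic2 (characteristic-two n≥1)
  open Pencil rootlessCubic
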